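{- Let $\Omega$ be a finite set of size $n$, let $F\in\Omega$ be a distinguished element, and let $G$ be a permutation group acting on $\Omega$. Let $\pi,\sigma\in G$. (a) The only points $x\in\Omega$ at which $\pi^{\triangle}(x)\neq\pi(x)$ or $\sigma^{\triangle}(x)\neq\sigma(x)$ lie in $\{\pi^{ -1}(F),\sigma^{ -1}(F),F\}$. Consequently $hd(\pi^{\triangle},\sigma^{\triangle})\ge hd(\pi,\sigma)-3$. (b) If $hd(\pi^{\triangle},\sigma^{\triangle})=hd(\pi,\sigma)-3$, then the disjoint cycle factorization of $\pi\sigma^{ -1}$ contains a $3$-cycle, and $|G|$ is divisible by $3$. (c) Let $S\subseteq G$. Then $|S^{\triangle}|=|S^{\triangle}_{ - }|$ and $hd(S^{\triangle})=hd(S^{\triangle}_{ - })$. If moreover $hd(S)>3$, then $|S|=|S^{\triangle}|$.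
   Context: For permutations $\pi,\sigma$ of a finite set, $hd(\pi,\sigma)=|\{x:\pi(x)\neq\sigma(x)\}|$ (Hamming distance). For a set $A$ of permutations (a permutation array) with at least two elements, $hd(A)=\min\{hd(\pi,\sigma):\pi,\sigma\in A,\ \pi\neq\sigma\}$. Given a distinguished element $F\in\Omega$ and a permutation $\pi$ of $\Omega$, the permutation $\pi^{\triangle}$ of $\Omega$ is defined by $\pi^{\triangle}(\pi^{ -1}(F))=\pi(F)$, $\pi^{\triangle}(F)=F$, and $\pi^{\triangle}(x)=\pi(x)$ for all other $x$ (so $\pi^{\triangle}=\pi$ if $\pi(F)=F$; otherwise the image string of $\pi$ has the symbols $F$ and $\pi(F)$ swapped). $\pi^{\triangle}_{ - }$ is the restriction of $\pi^{\triangle}$ to $\Omega\setminus\{F\}$, a permutation of $\Omega\setminus\{F\}$. For a set $S$ of permutations, $S^{\triangle}=\{\pi^{\triangle}:\pi\in S\}$ and $S^{\triangle}_{ - }=\{\pi^{\triangle}_{ - }:\pi\in S\}$. -}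

module Defs where

open import Data.Nat using (ℕ; zero; suc; _⊓_; _<_)
open import Data.Fin using (Fin)
open import Data.Fin.Properties using (all?; _≟_)
open import Data.Fin.Permutation
  using (Permutation′; _⟨$⟩ʳ_; _⟨$⟩ˡ_; _≈_; id; flip; _∘ₚ_; transpose; remove)
open import Data.List using (List; []; _∷_; length; map; filter; foldr; deduplicate; _++_; allFin)
open import Data.List.Relation.Unary.Any using (Any)
open import Data.List.Relation.Unary.All using (All)
open import Data.List.Relation.Unary.AllPairs using (AllPairs)
open import Data.Maybe using (Maybe; just; nothing)
open import Data.Product using (_×_; _,_; Σ; ∃; proj₁; proj₂)
open import Relation.Nullary using (Dec; ¬_; ¬?)
open import Relation.Binary.PropositionalEquality using (_≡_; _≢_)

Perm : ℕ → Set
Perm k = Permutation′ k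

_≈?_ : ∀ {k} (π σ : Perm k) → Dec (π ≈ σ)
π ≈? σ = all? (λ i → π ⟨$⟩ʳ i ≟ σ ⟨$⟩ʳ i)

hd : ∀ {k} → Perm k → Perm k → ℕ
hd {k} π σ = length (filter (λ i → ¬? (π ⟨$⟩ʳ i ≟ σ ⟨$⟩ʳ i)) (allFin k))

-- A set of permutations is represented by a list; its distinct elements
-- (up to pointwise equality) are obtained by deduplication.
distinct : ∀ {k} → List (Perm k) → List (Perm k)
distinct = deduplicate _≈?_

card : ∀ {k} → List (Perm k) → ℕ
card A = length (distinct A)

pairs : ∀ {a} {A : Set a} → List A → List (A × A)
pairs [] = []
pairs (x ∷ xs) = map (λ y → (x , y)) xs ++ pairs xs

minimum? : List ℕ → Maybe ℕ
minimum? [] = nothing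
minimum? (d ∷ ds) = just (foldr _⊓_ d ds)

-- hd(A) = min { hd(π,σ) : π,σ ∈ A, π ≠ σ };  nothing if A has < 2 elements.
hdSet : ∀ {k} → List (Perm k) → Maybe ℕ
hdSet A = minimum? (map (λ p → hd (proj₁ p) (proj₂ p))
                        (pairs (distinct A)))

_∈ₚ_ : ∀ {k} → Perm k → List (Perm k) → Set
π ∈ₚ A = Any (π ≈_) A

-- A finite permutation group on Fin k, listed without repetitions;
-- its order |G| is the length of the list.
record IsPermGroup {k : ℕ} (G : List (Perm k)) : Set where
  field
    noDup    : AllPairs (λ π σ → ¬ (π ≈ σ)) G
    hasId    : id ∈ₚ G
    closed-∘ : ∀ π σ → π ∈ₚ G → σ ∈ₚ G → (π ∘ₚ σ) ∈ₚ G
    closed-⁻¹ : ∀ π → π ∈ₚ G → flip π ∈ₚ G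

-- π^△ : the image string of π with the symbols F and π(F) swapped,
-- i.e. first apply π, then the transposition (F π(F)).
-- (_∘ₚ_ is diagrammatic: (π ∘ₚ τ) x = τ (π x).)
tri : ∀ {k} → Fin k → Perm k → Perm k
tri F π = π ∘ₚ transpose F (π ⟨$⟩ʳ F)

-- π^△_- : restriction of π^△ (which fixes F) to Ω ∖ {F}, where Ω ∖ {F}
-- is identified with Fin m via punchOut/punchIn (stdlib `remove`).
tri₋ : ∀ {m} → Fin (suc m) → Perm (suc m) → Perm m
tri₋ F π = remove F (tri F π)

-- composition written right-to-left as in πσ⁻¹ : x ↦ π(σ⁻¹(x))
_·_ : ∀ {k} → Perm k → Perm k → Perm k
π · σ = σ ∘ₚ π

iter : ∀ {k} → Perm k → ℕ → Fin k → Fin k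
iter ρ zero a = a
iter ρ (suc j) a = ρ ⟨$⟩ʳ iter ρ j a

-- the disjoint cycle factorization of ρ contains a cycle of length ℓ
-- (ℓ ≥ 2): some point a has orbit of size exactly ℓ under ρ.
HasCycleOfLength : ∀ {k} → Perm k → ℕ → Set
HasCycleOfLength {k} ρ ℓ =
  Σ (Fin k) λ a → iter ρ ℓ a ≡ a × (∀ j → 0 < j → j < ℓ → iter ρ j a ≢ a)

-- π△ agrees with π except at π⁻¹(F) and F, so passing from (π, σ) to (π△, σ△)
-- can heal at most the three disagreements at a = π⁻¹(F), b = σ⁻¹(F) and F.
-- If all three are healed, π△ a = σ△ a and π△ b = σ△ b give σ a = π F and
-- π b = σ F, so F ↦ σ F ↦ π F ↦ F is a 3-cycle of ρ = πσ⁻¹.  Then 3 divides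
-- every period of ρ, some power τ of ρ has order exactly 3, and g ↦ gτ splits G
-- into orbits of size 3.  Since π△ fixes F, deleting F changes neither equality
-- nor Hamming distance of such permutations; and when hd(S) > 3, π ↦ π△ is
-- injective on S because it lowers distances by at most 3.

module Submission where

open import Defs
open import Data.Nat
  using (ℕ; zero; suc; _+_; _*_; _∸_; _⊓_; _/_; _%_; _≤_; _<_; z≤n; z<s; s≤s; s≤s⁻¹; NonZero)
open import Data.Nat.DivMod using (m≡m%n+[m/n]*n; m%n<n)
open import Data.Nat.Induction using (<-wellFounded)
open import Induction.WellFounded using (Acc; acc)
open import Data.Nat.Properties
  using ( ≤-refl; ≤-reflexive; ≤-trans; <-irrefl; <⇒≤; 1+n≰n; n≤1+n; n<1+n; n≢0⇒n>0
        ; +-suc; +-comm; +-cancelˡ-≤; +-mono-≤; +-monoʳ-≤; +-monoˡ-≤; *-comm; m<m*n; m<n+m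
        ; m∸n+n≡m; m<n⇒0<n∸m; m≤n+o⇒m∸n≤o; m⊓n≤m; m⊓n≤n; module ≤-Reasoning)
  renaming (_≟_ to _≟ℕ_)
open import Data.Nat.Divisibility using (_∣_; divides; m%n≡0⇒n∣m; ∣-refl; ∣m∣n⇒∣m+n)
open import Data.Fin using (Fin; zero; suc; punchIn; punchOut; toℕ)
open import Data.Fin.Properties using (_≟_; punchInᵢ≢i; punchIn-injective; punchIn-punchOut; all?; pigeonhole)
open import Data.Fin.Permutation
  using (_⟨$⟩ʳ_; _⟨$⟩ˡ_; _≈_; _∘ₚ_; flip; transpose; remove; punchIn-permute; inverseˡ; inverseʳ)
  renaming (id to idₚ)
open import Data.List using (List; []; _∷_; [_]; length; map; filter; tabulate; allFin; _++_; lookup; deduplicate; foldr)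
open import Data.List.Properties
  using ( filter-accept; filter-reject; filter-none; filter-all; filter-≐; filter-++
        ; length-++; length-map; map-tabulate; map-∘; map-++; map-cong; map-id)
open import Data.List.Membership.Propositional using (_∈_; find)
open import Data.List.Membership.Propositional.Properties using (∈-map⁺; ∈-++⁺ˡ; ∈-++⁺ʳ; ∈-deduplicate⁻)
import Data.List.Membership.DecPropositional as DecMembership
import Data.List.Membership.Setoid as SetoidMembership
open import Data.List.Membership.Setoid.Properties using (∈-filter⁺; ∈-filter⁻)
import Data.List.Relation.Unary.Unique.Setoid as SetoidUnique
open import Data.List.Relation.Unary.Unique.Setoid.Properties using (filter⁺)
open import Data.List.Relation.Unary.Any as Any using (here; there)
open import Data.List.Relation.Unary.Any.Properties as Any using (lookup-index)
open import Data.List.Relation.Unary.All as All using (All; []; _∷_)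
open import Data.List.Relation.Unary.AllPairs using ([]; _∷_)
open import Data.List.Relation.Unary.Unique.Propositional using (Unique)
open import Data.List.Relation.Binary.Permutation.Propositional using (_↭_; ↭-reflexive; ↭-trans; ↭-prep; ↭-swap)
import Data.List.Relation.Binary.Permutation.Propositional.Properties as ↭
open import Data.Maybe using (just)
open import Data.Product as Product using (_×_; _,_; proj₁; proj₂; ∃-syntax)
open import Data.Sum as Sum using (_⊎_; inj₁; inj₂)
open import Function using (_∘_; id)
open import Function.Bundles using (_⇔_; mk⇔; Equivalence)
open import Function.Related.TypeIsomorphisms using (¬-cong-⇔)
open import Level using (Level; 0ℓ)
open import Relation.Nullary using (yes; no; ¬_; ¬?; contradiction)
open import Relation.Nullary.Decidable using (_×-dec_; dec-true; dec-false)
open import Relation.Binary using (DecSetoid; _Respects_; Rel)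
import Relation.Binary as B
open import Relation.Unary using (Pred; Decidable; _⊆_; _∪_; _≐_)
open import Relation.Binary.PropositionalEquality
  using (_≡_; _≢_; _≗_; refl; sym; trans; cong; cong₂; subst; ≢-sym; module ≡-Reasoning)

private
  variable
    α p : Level
    A : Set α

module _ {P : Pred A p} (P? : Decidable P) where

  length-filter-∷ : ∀ x xs → length (filter P? xs) ≤ length (filter P? (x ∷ xs))
  length-filter-∷ x xs with P? x
  ... | yes _ = n≤1+n _
  ... | no _ = ≤-refl

module _ {p q r} {P : Pred A p} {Q : Pred A q} {R : Pred A r} (P? : Decidable P) (Q? : Decidable Q) (R? : Decidable R) where

  length-filter-∪ : P ⊆ Q ∪ R → ∀ xs →
    length (filter P? xs) ≤ length (filter Q? xs) + length (filter R? xs)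
  length-filter-∪ P⊆Q∪R [] = z≤n
  length-filter-∪ P⊆Q∪R (x ∷ xs) with ih ← length-filter-∪ P⊆Q∪R xs | P? x
  ... | no _ = ≤-trans ih (+-mono-≤ (length-filter-∷ Q? x xs) (length-filter-∷ R? x xs))
  ... | yes px with P⊆Q∪R px
  ...   | inj₁ qx = begin
    suc (length (filter P? xs))                                ≤⟨ s≤s ih ⟩
    suc (length (filter Q? xs) + length (filter R? xs))        ≤⟨ s≤s (+-monoʳ-≤ _ (length-filter-∷ R? x xs)) ⟩
    length (x ∷ filter Q? xs) + length (filter R? (x ∷ xs))    ≡⟨ cong (λ ys → length ys + _) (filter-accept Q? qx) ⟨
    length (filter Q? (x ∷ xs)) + length (filter R? (x ∷ xs))  ∎
    where open ≤-Reasoning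
  ...   | inj₂ rx = begin
    suc (length (filter P? xs))                                ≤⟨ s≤s ih ⟩
    suc (length (filter Q? xs) + length (filter R? xs))        ≤⟨ s≤s (+-monoˡ-≤ _ (length-filter-∷ Q? x xs)) ⟩
    suc (length (filter Q? (x ∷ xs)) + length (filter R? xs))  ≡⟨ +-suc _ _ ⟨
    length (filter Q? (x ∷ xs)) + length (x ∷ filter R? xs)    ≡⟨ cong (λ ys → _ + length ys) (filter-accept R? rx) ⟨
    length (filter Q? (x ∷ xs)) + length (filter R? (x ∷ xs))  ∎
    where open ≤-Reasoning

filter-map : ∀ {b} {B : Set b} {P : Pred B p} (P? : Decidable P) (f : A → B) xs →
  filter P? (map f xs) ≡ map f (filter (P? ∘ f) xs)
filter-map P? f [] = refl
filter-map P? f (x ∷ xs) with P? (f x)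
... | yes _ = cong (f x ∷_) (filter-map P? f xs)
... | no _ = filter-map P? f xs

module _ {P : Pred A p} {Q : Pred A p} (P? : Decidable P) (Q? : Decidable Q) where

  filter-cong : ∀ {xs} → All (λ x → P x ⇔ Q x) xs → filter P? xs ≡ filter Q? xs
  filter-cong [] = refl
  filter-cong {x ∷ xs} (Px⇔Qx ∷ P⇔Q) with P? x | Q? x
  ... | yes _ | yes _ = cong (x ∷_) (filter-cong P⇔Q)
  ... | yes px | no ¬qx = contradiction (Equivalence.to Px⇔Qx px) ¬qx
  ... | no ¬px | yes qx = contradiction (Equivalence.from Px⇔Qx qx) ¬px
  ... | no _ | no _ = filter-cong P⇔Q

module _ {R R′ : Rel A p} (R? : B.Decidable R) (R′? : B.Decidable R′) where

  deduplicate-cong : ∀ {xs} → (∀ {x y} → x ∈ xs → y ∈ xs → R x y ⇔ R′ x y) →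
    deduplicate R? xs ≡ deduplicate R′? xs
  deduplicate-cong {[]} _ = refl
  deduplicate-cong {x ∷ xs} R⇔R′ = cong (x ∷_) (begin
    filter (¬? ∘ R? x) (deduplicate R? xs)    ≡⟨ cong (filter (¬? ∘ R? x)) (deduplicate-cong (λ y∈ z∈ → R⇔R′ (there y∈) (there z∈))) ⟩
    filter (¬? ∘ R? x) (deduplicate R′? xs)   ≡⟨ filter-cong (¬? ∘ R? x) (¬? ∘ R′? x)
                                                   (All.tabulate (λ y∈ → ¬-cong-⇔ (R⇔R′ (here refl) (there (∈-deduplicate⁻ R′? xs y∈))))) ⟩
    filter (¬? ∘ R′? x) (deduplicate R′? xs)  ∎)
    where open ≡-Reasoning

deduplicate-map : ∀ {b} {B : Set b} {R : Rel B p} (R? : B.Decidable R) (f : A → B) xs →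
  deduplicate R? (map f xs) ≡ map f (deduplicate (λ x y → R? (f x) (f y)) xs)
deduplicate-map R? f [] = refl
deduplicate-map R? f (x ∷ xs) = cong (f x ∷_) (begin
  filter (¬? ∘ R? (f x)) (deduplicate R? (map f xs))          ≡⟨ cong (filter (¬? ∘ R? (f x))) (deduplicate-map R? f xs) ⟩
  filter (¬? ∘ R? (f x)) (map f (deduplicate R?∘f xs))         ≡⟨ filter-map (¬? ∘ R? (f x)) f (deduplicate R?∘f xs) ⟩
  map f (filter (¬? ∘ R? (f x) ∘ f) (deduplicate R?∘f xs))    ∎)
  where
  open ≡-Reasoning
  R?∘f = λ x y → R? (f x) (f y)

pairs-map : ∀ {b} {B : Set b} (f : A → B) xs → pairs (map f xs) ≡ map (Product.map f f) (pairs xs)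
pairs-map f [] = refl
pairs-map f (x ∷ xs) = begin
  map (f x ,_) (map f xs) ++ pairs (map f xs)
    ≡⟨ cong₂ _++_ (sym (map-∘ xs)) (pairs-map f xs) ⟩
  map ((f x ,_) ∘ f) xs ++ map (Product.map f f) (pairs xs)
    ≡⟨ cong (_++ _) (map-∘ xs) ⟩
  map (Product.map f f) (map (x ,_) xs) ++ map (Product.map f f) (pairs xs)
    ≡⟨ map-++ (Product.map f f) (map (x ,_) xs) (pairs xs) ⟨
  map (Product.map f f) (map (x ,_) xs ++ pairs xs)
    ∎
  where open ≡-Reasoning

∈-pairs : ∀ {x y : A} {xs} → x ∈ xs → y ∈ xs → x ≡ y ⊎ (x , y) ∈ pairs xs ⊎ (y , x) ∈ pairs xs
∈-pairs (here refl) (here refl) = inj₁ refl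
∈-pairs {xs = x ∷ xs} (here refl) (there y∈xs) = inj₂ (inj₁ (∈-++⁺ˡ (∈-map⁺ (x ,_) y∈xs)))
∈-pairs {xs = y ∷ xs} (there x∈xs) (here refl) = inj₂ (inj₂ (∈-++⁺ˡ (∈-map⁺ (y ,_) x∈xs)))
∈-pairs {xs = z ∷ xs} (there x∈xs) (there y∈xs) =
  Sum.map₂ (Sum.map (∈-++⁺ʳ (map (z ,_) xs)) (∈-++⁺ʳ (map (z ,_) xs))) (∈-pairs x∈xs y∈xs)

minimum?-≤ : ∀ {ds d e} → minimum? ds ≡ just d → e ∈ ds → d ≤ e
minimum?-≤ {d₀ ∷ ds} refl = foldr-⊓-≤ d₀ ds
  where
  foldr-⊓-≤ : ∀ d₀ ds {e} → e ∈ d₀ ∷ ds → foldr _⊓_ d₀ ds ≤ e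
  foldr-⊓-≤ d₀ [] (here refl) = ≤-refl
  foldr-⊓-≤ d₀ (d ∷ ds) (here refl) = ≤-trans (m⊓n≤n d _) (foldr-⊓-≤ d₀ ds (here refl))
  foldr-⊓-≤ d₀ (d ∷ ds) (there (here refl)) = m⊓n≤m d _
  foldr-⊓-≤ d₀ (d ∷ ds) (there (there e∈ds)) = ≤-trans (m⊓n≤n d _) (foldr-⊓-≤ d₀ ds (there e∈ds))

allFin-punchIn : ∀ {n} (i : Fin (suc n)) → allFin (suc n) ↭ i ∷ map (punchIn i) (allFin n)
allFin-punchIn zero = ↭-reflexive (cong (zero ∷_) (sym (map-tabulate id suc)))
allFin-punchIn {suc n} (suc i) = ↭-trans
  (↭-reflexive (cong (zero ∷_) (sym (map-tabulate id suc))))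
  (↭-trans (↭-prep zero (↭.map⁺ suc (allFin-punchIn i)))
           (↭-swap zero (suc i) (↭-reflexive shifted)))
  where
  shifted : map suc (map (punchIn i) (allFin n)) ≡ map (punchIn (suc i)) (tabulate suc)
  shifted = trans (sym (map-∘ (allFin n)))
                  (trans (map-tabulate id (suc ∘ punchIn i))
                         (sym (map-tabulate suc (punchIn (suc i)))))

count : ∀ {n} {P : Pred (Fin n) p} → Decidable P → ℕ
count {n = n} P? = length (filter P? (allFin n))

module _ {n : ℕ} {P : Pred (Fin n) p} (P? : Decidable P) where

  count-cong : ∀ {Q : Pred (Fin n) p} (Q? : Decidable Q) → P ≐ Q → count P? ≡ count Q?
  count-cong Q? P≐Q = cong length (filter-≐ P? Q? P≐Q (allFin n))

  count-none : (∀ x → ¬ P x) → count P? ≡ 0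
  count-none ¬P = cong length (filter-none P? (All.universal ¬P (allFin n)))

module _ {n : ℕ} {P : Pred (Fin (suc n)) p} (P? : Decidable P) where

  count-punchIn : ∀ i → count P? ≡ length (filter P? [ i ]) + count (P? ∘ punchIn i)
  count-punchIn i = begin
    count P?
      ≡⟨ ↭.↭-length (↭.filter-↭ P? (allFin-punchIn i)) ⟩
    length (filter P? ([ i ] ++ map (punchIn i) (allFin n)))
      ≡⟨ cong length (filter-++ P? [ i ] _) ⟩
    length (filter P? [ i ] ++ filter P? (map (punchIn i) (allFin n)))
      ≡⟨ length-++ (filter P? [ i ]) ⟩
    length (filter P? [ i ]) + length (filter P? (map (punchIn i) (allFin n)))
      ≡⟨ cong (λ ys → length (filter P? [ i ]) + length ys) (filter-map P? (punchIn i) (allFin n)) ⟩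
    length (filter P? [ i ]) + length (map (punchIn i) (filter (P? ∘ punchIn i) (allFin n)))
      ≡⟨ cong (length (filter P? [ i ]) +_) (length-map (punchIn i) (filter (P? ∘ punchIn i) (allFin n))) ⟩
    length (filter P? [ i ]) + count (P? ∘ punchIn i)
      ∎
    where open ≡-Reasoning

count-≡ : ∀ {n} (i : Fin n) → count (_≟ i) ≡ 1
count-≡ {suc _} i = begin
  count (_≟ i)                                   ≡⟨ count-punchIn (_≟ i) i ⟩
  length (filter (_≟ i) [ i ]) + count punchIn≡? ≡⟨ cong (λ ys → length ys + count punchIn≡?) (filter-accept (_≟ i) refl) ⟩
  suc (count punchIn≡?)                          ≡⟨ cong suc (count-none punchIn≡? (punchInᵢ≢i i)) ⟩
  1                                              ∎
  where
  open ≡-Reasoning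
  punchIn≡? = λ j → punchIn i j ≟ i

module _ {n : ℕ} {P : Pred (Fin n) p} (P? : Decidable P) where

  count≤1+count-≢ : ∀ y → count P? ≤ suc (count (λ x → P? x ×-dec ¬? (x ≟ y)))
  count≤1+count-≢ y = begin
    count P?                   ≤⟨ length-filter-∪ P? (_≟ y) P≢y? split (allFin n) ⟩
    count (_≟ y) + count P≢y?  ≡⟨ cong (_+ count P≢y?) (count-≡ y) ⟩
    suc (count P≢y?)           ∎
    where
    open ≤-Reasoning
    P≢y? = λ x → P? x ×-dec ¬? (x ≟ y)
    split : P ⊆ (_≡ y) ∪ (λ x → P x × x ≢ y)
    split {x} px with x ≟ y
    ... | yes x≡y = inj₁ x≡y
    ... | no x≢y = inj₂ (px , x≢y)

⊆-∷⇒⊆ : ∀ {P : Pred A p} {y ys} → P ⊆ (_∈ y ∷ ys) → (λ x → P x × x ≢ y) ⊆ (_∈ ys)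
⊆-∷⇒⊆ P⊆y∷ys (px , x≢y) with P⊆y∷ys px
... | here x≡y = contradiction x≡y x≢y
... | there x∈ys = x∈ys

count≤length : ∀ {n} {P : Pred (Fin n) p} (P? : Decidable P) {ys} → P ⊆ (_∈ ys) → count P? ≤ length ys
count≤length P? {[]} P⊆[] = ≤-reflexive (count-none P? (λ x px → contradiction (P⊆[] px) λ ()))
count≤length P? {y ∷ ys} P⊆y∷ys =
  ≤-trans (count≤1+count-≢ P? y) (s≤s (count≤length _ (⊆-∷⇒⊆ P⊆y∷ys)))

length≤count⇒All×Unique : ∀ {n} {P : Pred (Fin n) p} (P? : Decidable P) {ys} → P ⊆ (_∈ ys) →
  length ys ≤ count P? → All P ys × Unique ys
length≤count⇒All×Unique P? {[]} _ _ = [] , []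
length≤count⇒All×Unique P? {y ∷ ys} P⊆y∷ys y∷ys≤P with P? y
... | no ¬py =
  contradiction (≤-trans y∷ys≤P (count≤length P? (λ px → ⊆-∷⇒⊆ P⊆y∷ys (px , λ { refl → ¬py px })))) 1+n≰n
... | yes py
  with P≢y-ys , unique-ys ← length≤count⇒All×Unique _ (⊆-∷⇒⊆ P⊆y∷ys)
                              (s≤s⁻¹ (≤-trans y∷ys≤P (count≤1+count-≢ P? y)))
  = (py ∷ All.map proj₁ P≢y-ys) , (All.map (≢-sym ∘ proj₂) P≢y-ys ∷ unique-ys)

module _ {n : ℕ} (i j : Fin n) where

  transpose-matchˡ : transpose i j ⟨$⟩ʳ i ≡ j
  transpose-matchˡ rewrite dec-true (i ≟ i) refl = refl

  transpose-matchʳ : transpose i j ⟨$⟩ʳ j ≡ i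
  transpose-matchʳ with j ≟ i
  ... | yes j≡i = j≡i
  ... | no _ rewrite dec-true (j ≟ j) refl = refl

  transpose-other : ∀ {k} → k ≢ i → k ≢ j → transpose i j ⟨$⟩ʳ k ≡ k
  transpose-other {k} k≢i k≢j rewrite dec-false (k ≟ i) k≢i | dec-false (k ≟ j) k≢j = refl

module _ {n : ℕ} (π : Perm n) where

  ⟨$⟩ʳ≡⇒≡⟨$⟩ˡ : ∀ {x y} → π ⟨$⟩ʳ x ≡ y → x ≡ π ⟨$⟩ˡ y
  ⟨$⟩ʳ≡⇒≡⟨$⟩ˡ πx≡y = trans (sym (inverseˡ π)) (cong (π ⟨$⟩ˡ_) πx≡y)

  ⟨$⟩ʳ-injective : ∀ {x y} → π ⟨$⟩ʳ x ≡ π ⟨$⟩ʳ y → x ≡ y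
  ⟨$⟩ʳ-injective πx≡πy = trans (⟨$⟩ʳ≡⇒≡⟨$⟩ˡ πx≡πy) (inverseˡ π)

module _ {n : ℕ} (F : Fin n) (π : Perm n) where

  tri-F : tri F π ⟨$⟩ʳ F ≡ F
  tri-F = transpose-matchʳ F (π ⟨$⟩ʳ F)

  tri-preimage : tri F π ⟨$⟩ʳ (π ⟨$⟩ˡ F) ≡ π ⟨$⟩ʳ F
  tri-preimage = trans (cong (transpose F (π ⟨$⟩ʳ F) ⟨$⟩ʳ_) (inverseʳ π)) (transpose-matchˡ F (π ⟨$⟩ʳ F))

  tri-other : ∀ {x} → x ≢ F → x ≢ π ⟨$⟩ˡ F → tri F π ⟨$⟩ʳ x ≡ π ⟨$⟩ʳ x
  tri-other x≢F x≢a = transpose-other F (π ⟨$⟩ʳ F) (x≢a ∘ ⟨$⟩ʳ≡⇒≡⟨$⟩ˡ π) (x≢F ∘ ⟨$⟩ʳ-injective π)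

  tri-moves : ∀ {x} → tri F π ⟨$⟩ʳ x ≢ π ⟨$⟩ʳ x → x ≡ π ⟨$⟩ˡ F ⊎ x ≡ F
  tri-moves {x} moved with x ≟ π ⟨$⟩ˡ F | x ≟ F
  ... | yes x≡a | _ = inj₁ x≡a
  ... | no _ | yes x≡F = inj₂ x≡F
  ... | no x≢a | no x≢F = contradiction (tri-other x≢F x≢a) moved

module _ {n : ℕ} where

  -- hd π σ is definitionally count (disagree? π σ).
  disagree? : (π σ : Perm n) → Decidable (λ x → π ⟨$⟩ʳ x ≢ σ ⟨$⟩ʳ x)
  disagree? π σ x = ¬? (π ⟨$⟩ʳ x ≟ σ ⟨$⟩ʳ x)

  hd-cong : ∀ {π π′ σ σ′ : Perm n} → π ≈ π′ → σ ≈ σ′ → hd π σ ≡ hd π′ σ′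
  hd-cong {π} {π′} {σ} {σ′} π≈π′ σ≈σ′ = count-cong (disagree? π σ) (disagree? π′ σ′)
    ( (λ {x} πx≢σx π′x≡σ′x → πx≢σx (trans (π≈π′ x) (trans π′x≡σ′x (sym (σ≈σ′ x)))))
    , (λ {x} π′x≢σ′x πx≡σx → π′x≢σ′x (trans (sym (π≈π′ x)) (trans πx≡σx (σ≈σ′ x)))))

  hd-comm : ∀ (π σ : Perm n) → hd π σ ≡ hd σ π
  hd-comm π σ = count-cong (disagree? π σ) (disagree? σ π) ((_∘ sym) , (_∘ sym))

  hd-≈ : ∀ {π σ : Perm n} → π ≈ σ → hd π σ ≡ 0
  hd-≈ {π} {σ} π≈σ = count-none (disagree? π σ) (λ x πx≢σx → πx≢σx (π≈σ x))

hasCycleOfLength-3 : ∀ {n} {ρ : Perm n} {a} → iter ρ 3 a ≡ a → ρ ⟨$⟩ʳ a ≢ a → HasCycleOfLength ρ 3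
hasCycleOfLength-3 {ρ = ρ} {a} ρ³a≡a ρa≢a = a , ρ³a≡a , moves
  where
  moves : ∀ j → 0 < j → j < 3 → iter ρ j a ≢ a
  moves 1 _ _ = ρa≢a
  moves 2 _ _ ρ²a≡a = ρa≢a (trans (cong (ρ ⟨$⟩ʳ_) (sym ρ²a≡a)) ρ³a≡a)
  moves (suc (suc (suc _))) _ (s≤s (s≤s (s≤s ())))

module _ {n : ℕ} (F : Fin n) (π σ : Perm n) where

  Healed : Pred (Fin n) _
  Healed x = π ⟨$⟩ʳ x ≢ σ ⟨$⟩ʳ x × tri F π ⟨$⟩ʳ x ≡ tri F σ ⟨$⟩ʳ x

  healed? : Decidable Healed
  healed? x = disagree? π σ x ×-dec (tri F π ⟨$⟩ʳ x ≟ tri F σ ⟨$⟩ʳ x)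

  hd≤hd-tri+healed : hd π σ ≤ hd (tri F π) (tri F σ) + count healed?
  hd≤hd-tri+healed = length-filter-∪ (disagree? π σ) (disagree? (tri F π) (tri F σ)) healed? split (allFin n)
    where
    split : (λ x → π ⟨$⟩ʳ x ≢ σ ⟨$⟩ʳ x) ⊆ (λ x → tri F π ⟨$⟩ʳ x ≢ tri F σ ⟨$⟩ʳ x) ∪ Healed
    split {x} πx≢σx with tri F π ⟨$⟩ʳ x ≟ tri F σ ⟨$⟩ʳ x
    ... | yes agree = inj₂ (πx≢σx , agree)
    ... | no disagree = inj₁ disagree

  Healed⊆ : Healed ⊆ (_∈ (π ⟨$⟩ˡ F) ∷ (σ ⟨$⟩ˡ F) ∷ F ∷ [])
  Healed⊆ {x} (πx≢σx , agree) with DecMembership._∈?_ _≟_ x ((π ⟨$⟩ˡ F) ∷ (σ ⟨$⟩ˡ F) ∷ F ∷ [])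
  ... | yes x∈ = x∈
  ... | no x∉ = contradiction πx≡σx πx≢σx
    where
    x≢F : x ≢ F
    x≢F = x∉ ∘ there ∘ there ∘ here
    πx≡σx : π ⟨$⟩ʳ x ≡ σ ⟨$⟩ʳ x
    πx≡σx = trans (sym (tri-other F π x≢F (x∉ ∘ here))) (trans agree (tri-other F σ x≢F (x∉ ∘ there ∘ here)))

  hd≤3+hd-tri : hd π σ ≤ 3 + hd (tri F π) (tri F σ)
  hd≤3+hd-tri = begin
    hd π σ                                   ≤⟨ hd≤hd-tri+healed ⟩
    hd (tri F π) (tri F σ) + count healed?  ≤⟨ +-monoʳ-≤ _ (count≤length healed? Healed⊆) ⟩
    hd (tri F π) (tri F σ) + 3               ≡⟨ +-comm _ 3 ⟩
    3 + hd (tri F π) (tri F σ)               ∎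
    where open ≤-Reasoning

  hd-tri+3≡hd⇒3-cycle : hd (tri F π) (tri F σ) + 3 ≡ hd π σ → HasCycleOfLength (π · flip σ) 3
  hd-tri+3≡hd⇒3-cycle tight
    -- three healed points among a, b, F: all of them are healed and they are distinct
    with length≤count⇒All×Unique healed? Healed⊆
           (+-cancelˡ-≤ (hd (tri F π) (tri F σ)) 3 _ (≤-trans (≤-reflexive tight) hd≤hd-tri+healed))
  ... | (_ , agree-a) ∷ (_ , agree-b) ∷ _ ∷ [] , (a≢b ∷ a≢F ∷ []) ∷ (b≢F ∷ []) ∷ [] ∷ [] =
    hasCycleOfLength-3 ρ³F≡F (b≢F ∘ sym ∘ ⟨$⟩ʳ≡⇒≡⟨$⟩ˡ σ ∘ trans (sym πb≡σF))
    where
    open ≡-Reasoning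
    a = π ⟨$⟩ˡ F
    b = σ ⟨$⟩ˡ F
    ρ = π · flip σ
    σa≡πF : σ ⟨$⟩ʳ a ≡ π ⟨$⟩ʳ F
    σa≡πF = begin
      σ ⟨$⟩ʳ a        ≡⟨ tri-other F σ a≢F a≢b ⟨
      tri F σ ⟨$⟩ʳ a  ≡⟨ agree-a ⟨
      tri F π ⟨$⟩ʳ a  ≡⟨ tri-preimage F π ⟩
      π ⟨$⟩ʳ F        ∎
    πb≡σF : π ⟨$⟩ʳ b ≡ σ ⟨$⟩ʳ F
    πb≡σF = begin
      π ⟨$⟩ʳ b        ≡⟨ tri-other F π b≢F (a≢b ∘ sym) ⟨
      tri F π ⟨$⟩ʳ b  ≡⟨ agree-b ⟩
      tri F σ ⟨$⟩ʳ b  ≡⟨ tri-preimage F σ ⟩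
      σ ⟨$⟩ʳ F        ∎
    ρ³F≡F : iter ρ 3 F ≡ F
    ρ³F≡F = begin
      ρ ⟨$⟩ʳ (ρ ⟨$⟩ʳ (π ⟨$⟩ʳ b))                  ≡⟨ cong (λ y → ρ ⟨$⟩ʳ (π ⟨$⟩ʳ y)) (trans (cong (σ ⟨$⟩ˡ_) πb≡σF) (inverseˡ σ)) ⟩
      ρ ⟨$⟩ʳ (π ⟨$⟩ʳ F)                           ≡⟨ cong (λ y → π ⟨$⟩ʳ (σ ⟨$⟩ˡ y)) σa≡πF ⟨
      π ⟨$⟩ʳ (σ ⟨$⟩ˡ (σ ⟨$⟩ʳ a))                  ≡⟨ cong (π ⟨$⟩ʳ_) (inverseˡ σ) ⟩
      π ⟨$⟩ʳ a                                    ≡⟨ inverseʳ π ⟩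
      F                                           ∎

module _ {n : ℕ} (ρ : Perm n) where

  iter-+ : ∀ j k x → iter ρ (j + k) x ≡ iter ρ j (iter ρ k x)
  iter-+ zero k x = refl
  iter-+ (suc j) k x = cong (ρ ⟨$⟩ʳ_) (iter-+ j k x)

  iter-* : ∀ {ℓ a} → iter ρ ℓ a ≡ a → ∀ q → iter ρ (q * ℓ) a ≡ a
  iter-* ρˡa≡a zero = refl
  iter-* {ℓ} {a} ρˡa≡a (suc q) = trans (iter-+ ℓ (q * ℓ) a) (trans (cong (iter ρ ℓ) (iter-* ρˡa≡a q)) ρˡa≡a)

  cycle-length-∣ : ∀ {ℓ a} .{{_ : NonZero ℓ}} → iter ρ ℓ a ≡ a → (∀ j → 0 < j → j < ℓ → iter ρ j a ≢ a) →
    ∀ s → iter ρ s a ≡ a → ℓ ∣ s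
  cycle-length-∣ {ℓ} {a} ρˡa≡a moves s ρˢa≡a with s % ℓ ≟ℕ 0
  ... | yes s%ℓ≡0 = m%n≡0⇒n∣m s ℓ s%ℓ≡0
  ... | no s%ℓ≢0 = contradiction returns (moves (s % ℓ) (n≢0⇒n>0 s%ℓ≢0) (m%n<n s ℓ))
    where
    open ≡-Reasoning
    returns : iter ρ (s % ℓ) a ≡ a
    returns = begin
      iter ρ (s % ℓ) a                         ≡⟨ cong (iter ρ (s % ℓ)) (iter-* ρˡa≡a (s / ℓ)) ⟨
      iter ρ (s % ℓ) (iter ρ (s / ℓ * ℓ) a)    ≡⟨ iter-+ (s % ℓ) (s / ℓ * ℓ) a ⟨
      iter ρ (s % ℓ + s / ℓ * ℓ) a             ≡⟨ cong (λ t → iter ρ t a) (m≡m%n+[m/n]*n s ℓ) ⟨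
      iter ρ s a                               ≡⟨ ρˢa≡a ⟩
      a                                        ∎

  power-of-order : ∀ {ℓ} → 1 < ℓ → (∀ s → iter ρ s ≗ id → ℓ ∣ s) →
    ∀ s → 0 < s → iter ρ s ≗ id → ∃[ u ] iter ρ (ℓ * u) ≗ id × ¬ (iter ρ u ≗ id)
  power-of-order {ℓ} 1<ℓ ℓ∣period s = go s (<-wellFounded s)
    where
    go : ∀ s → Acc _<_ s → 0 < s → iter ρ s ≗ id → ∃[ u ] iter ρ (ℓ * u) ≗ id × ¬ (iter ρ u ≗ id)
    go s (acc smaller) 0<s ρˢ≗id with ℓ∣period s ρˢ≗id
    ... | divides zero refl = contradiction 0<s λ ()
    ... | divides u@(suc _) refl with all? (λ x → iter ρ u x ≟ x)
    ...   | no ρᵘ≉id = u , (λ x → trans (cong (λ t → iter ρ t x) (*-comm ℓ u)) (ρˢ≗id x)) , ρᵘ≉id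
    ...   | yes ρᵘ≗id = go u (smaller (m<m*n u ℓ 1<ℓ)) z<s ρᵘ≗id

  pow : ℕ → Perm n
  pow zero = idₚ
  pow (suc i) = pow i ∘ₚ ρ

  pow-apply : ∀ i x → pow i ⟨$⟩ʳ x ≡ iter ρ i x
  pow-apply zero x = refl
  pow-apply (suc i) x = cong (ρ ⟨$⟩ʳ_) (pow-apply i x)

  iter-pow : ∀ u j x → iter (pow u) j x ≡ iter ρ (j * u) x
  iter-pow u zero x = refl
  iter-pow u (suc j) x = begin
    pow u ⟨$⟩ʳ iter (pow u) j x    ≡⟨ cong (pow u ⟨$⟩ʳ_) (iter-pow u j x) ⟩
    pow u ⟨$⟩ʳ iter ρ (j * u) x    ≡⟨ pow-apply u _ ⟩
    iter ρ u (iter ρ (j * u) x)   ≡⟨ iter-+ u (j * u) x ⟨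
    iter ρ (u + j * u) x          ∎
    where open ≡-Reasoning

  pow≈pow⇒period : ∀ {i j} → i ≤ j → pow i ≈ pow j → iter ρ (j ∸ i) ≗ id
  pow≈pow⇒period {i} {j} i≤j ρⁱ≈ρʲ y = begin
    iter ρ (j ∸ i) y                ≡⟨ cong (iter ρ (j ∸ i)) y≡ρⁱx ⟩
    iter ρ (j ∸ i) (iter ρ i x)     ≡⟨ iter-+ (j ∸ i) i x ⟨
    iter ρ (j ∸ i + i) x            ≡⟨ cong (λ t → iter ρ t x) (m∸n+n≡m i≤j) ⟩
    iter ρ j x                      ≡⟨ trans (sym (pow-apply j x)) (trans (sym (ρⁱ≈ρʲ x)) (pow-apply i x)) ⟩
    iter ρ i x                      ≡⟨ y≡ρⁱx ⟨
    y                               ∎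
    where
    open ≡-Reasoning
    x = pow i ⟨$⟩ˡ y
    y≡ρⁱx : y ≡ iter ρ i x
    y≡ρⁱx = trans (sym (inverseʳ (pow i))) (pow-apply i x)

module _ {c ℓ} (S : DecSetoid c ℓ) where
  open DecSetoid S using (setoid)
    renaming (Carrier to X; _≈_ to _≈ₓ_; _≟_ to _≟ₓ_; refl to ≈-refl; sym to ≈-sym; trans to ≈-trans)
  open SetoidMembership setoid using () renaming (_∈_ to _∈ₓ_)
  open SetoidUnique setoid using () renaming (Unique to Uniqueₓ)

  delete : X → List X → List X
  delete y = filter (λ z → ¬? (y ≟ₓ z))

  private
    ≉-respʳ : ∀ {y} → (λ z → ¬ y ≈ₓ z) Respects _≈ₓ_
    ≉-respʳ z≈z′ y≉z y≈z′ = y≉z (≈-trans y≈z′ (≈-sym z≈z′))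

  ∈-delete⁺ : ∀ {x y xs} → x ∈ₓ xs → ¬ y ≈ₓ x → x ∈ₓ delete y xs
  ∈-delete⁺ = ∈-filter⁺ setoid (λ z → ¬? (_ ≟ₓ z)) ≉-respʳ

  ∈-delete⁻ : ∀ {x y xs} → x ∈ₓ delete y xs → x ∈ₓ xs × ¬ y ≈ₓ x
  ∈-delete⁻ = ∈-filter⁻ setoid (λ z → ¬? (_ ≟ₓ z)) ≉-respʳ

  length-delete : ∀ {y xs} → Uniqueₓ xs → y ∈ₓ xs → suc (length (delete y xs)) ≡ length xs
  length-delete {y} {w ∷ ws} (w≉ws ∷ unique) y∈w∷ws with y ≟ₓ w | y∈w∷ws
  ... | yes y≈w | _ = cong (suc ∘ length)
    (filter-all (λ z → ¬? (y ≟ₓ z)) (All.map (λ w≉z y≈z → w≉z (≈-trans (≈-sym y≈w) y≈z)) w≉ws))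
  ... | no y≉w | here y≈w = contradiction y≈w y≉w
  ... | no y≉w | there y∈ws = cong suc (length-delete unique y∈ws)

  module _ {f : X → X} (f-cong : ∀ {x y} → x ≈ₓ y → f x ≈ₓ f y)
           (f³≈id : ∀ x → f (f (f x)) ≈ₓ x) (f-free : ∀ x → ¬ f x ≈ₓ x) where

    f-injective : ∀ {x y} → f x ≈ₓ f y → x ≈ₓ y
    f-injective {x} {y} fx≈fy = ≈-trans (≈-sym (f³≈id x)) (≈-trans (f-cong (f-cong fx≈fy)) (f³≈id y))

    3∣length : ∀ {xs} → Uniqueₓ xs → (∀ {x} → x ∈ₓ xs → f x ∈ₓ xs) → 3 ∣ length xs
    3∣length {xs} = go xs (<-wellFounded (length xs))
      where
      go : ∀ xs → Acc _<_ (length xs) → Uniqueₓ xs → (∀ {x} → x ∈ₓ xs → f x ∈ₓ xs) → 3 ∣ length xs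
      go [] _ _ _ = divides 0 refl
      go (x ∷ rest) (acc smaller) (x≉rest ∷ unique) closed =
        subst (3 ∣_) (sym length≡) (∣m∣n⇒∣m+n ∣-refl (go rest″ (smaller rest″<) unique″ closed″))
        where
        x∉rest : ∀ {z} → z ∈ₓ rest → ¬ x ≈ₓ z
        x∉rest = All.lookupₛ setoid ≉-respʳ x≉rest
        fx∈rest : f x ∈ₓ rest
        fx∈rest with closed (here ≈-refl)
        ... | here fx≈x = contradiction fx≈x (f-free x)
        ... | there fx∈rest = fx∈rest
        f²x∈rest : f (f x) ∈ₓ rest
        f²x∈rest with closed (there fx∈rest)
        ... | here f²x≈x = contradiction (≈-trans (≈-sym (f-cong f²x≈x)) (f³≈id x)) (f-free x)
        ... | there f²x∈rest = f²x∈rest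
        rest′ = delete (f x) rest
        rest″ = delete (f (f x)) rest′
        f²x∈rest′ : f (f x) ∈ₓ rest′
        f²x∈rest′ = ∈-delete⁺ f²x∈rest (f-free (f x) ∘ ≈-sym)
        length≡ : length (x ∷ rest) ≡ 3 + length rest″
        length≡ = sym (cong suc (trans (cong suc (length-delete (filter⁺ setoid _ unique) f²x∈rest′))
                                       (length-delete unique fx∈rest)))
        rest″< : length rest″ < length (x ∷ rest)
        rest″< = subst (length rest″ <_) (sym length≡) (m<n+m (length rest″) z<s)
        unique″ : Uniqueₓ rest″
        unique″ = filter⁺ setoid _ (filter⁺ setoid _ unique)
        closed″ : ∀ {z} → z ∈ₓ rest″ → f z ∈ₓ rest″
        closed″ z∈rest″ with ∈-delete⁻ z∈rest″
        ... | z∈rest′ , f²x≉z with ∈-delete⁻ z∈rest′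
        ...   | z∈rest , fx≉z with closed (there z∈rest)
        ...     | here fz≈x = contradiction (≈-sym (f-injective (≈-trans fz≈x (≈-sym (f³≈id x))))) f²x≉z
        ...     | there fz∈rest = ∈-delete⁺ (∈-delete⁺ fz∈rest (x∉rest z∈rest ∘ f-injective))
                                            (fx≉z ∘ f-injective)

≈-decSetoid : ℕ → DecSetoid 0ℓ 0ℓ
≈-decSetoid n = record
  { Carrier = Perm n
  ; _≈_ = _≈_
  ; isDecEquivalence = record
    { isEquivalence = record
      { refl = λ _ → refl
      ; sym = λ π≈σ x → sym (π≈σ x)
      ; trans = λ π≈σ σ≈τ x → trans (π≈σ x) (σ≈τ x)
      }
    ; _≟_ = _≈?_
    }
  }

module _ {n : ℕ} {G : List (Perm n)} (isG : IsPermGroup G) where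
  open IsPermGroup isG

  pow∈G : ∀ {ρ} → ρ ∈ₚ G → ∀ i → pow ρ i ∈ₚ G
  pow∈G ρ∈G zero = hasId
  pow∈G {ρ} ρ∈G (suc i) = closed-∘ (pow ρ i) ρ (pow∈G ρ∈G i) ρ∈G

  period : ∀ {ρ} → ρ ∈ₚ G → ∃[ s ] 0 < s × iter ρ s ≗ id
  period {ρ} ρ∈G with pigeonhole (n<1+n (length G)) (Any.index ∘ pow∈G ρ∈G ∘ toℕ)
  ... | i , j , i<j , same-index = toℕ j ∸ toℕ i , m<n⇒0<n∸m i<j , pow≈pow⇒period ρ (<⇒≤ i<j) ρⁱ≈ρʲ
    where
    ρⁱ≈ρʲ : pow ρ (toℕ i) ≈ pow ρ (toℕ j)
    ρⁱ≈ρʲ x = trans (lookup-index (pow∈G ρ∈G (toℕ i)) x)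
      (trans (cong (λ k → lookup G k ⟨$⟩ʳ x) same-index) (sym (lookup-index (pow∈G ρ∈G (toℕ j)) x)))

  ∃power-of-order-3 : ∀ {ρ} → ρ ∈ₚ G → HasCycleOfLength ρ 3 → ∃[ u ] iter ρ (3 * u) ≗ id × ¬ (iter ρ u ≗ id)
  ∃power-of-order-3 {ρ} ρ∈G (a , ρ³a≡a , moves) with s , 0<s , ρˢ≗id ← period ρ∈G =
    power-of-order ρ (s≤s (s≤s z≤n)) (λ t ρᵗ≗id → cycle-length-∣ ρ ρ³a≡a moves t (ρᵗ≗id a)) s 0<s ρˢ≗id

  3∣order : ∀ {ρ} → ρ ∈ₚ G → HasCycleOfLength ρ 3 → 3 ∣ length G
  3∣order {ρ} ρ∈G ρ-cycle with u , ρ³ᵘ≗id , ρᵘ≉id ← ∃power-of-order-3 ρ∈G ρ-cycle =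
    3∣length (≈-decSetoid n) {f = _∘ₚ τ} (λ {g} {h} → f-cong {g} {h}) f³≈id f-free noDup
      (λ {g} g∈G → closed-∘ g τ g∈G (pow∈G ρ∈G u))
    where
    τ = pow ρ u
    f-cong : ∀ {g h : Perm n} → g ≈ h → g ∘ₚ τ ≈ h ∘ₚ τ
    f-cong g≈h x = cong (τ ⟨$⟩ʳ_) (g≈h x)
    f³≈id : ∀ (g : Perm n) → ((g ∘ₚ τ) ∘ₚ τ) ∘ₚ τ ≈ g
    f³≈id g x = begin
      iter τ 3 (g ⟨$⟩ʳ x)        ≡⟨ iter-pow ρ u 3 (g ⟨$⟩ʳ x) ⟩
      iter ρ (3 * u) (g ⟨$⟩ʳ x)  ≡⟨ ρ³ᵘ≗id (g ⟨$⟩ʳ x) ⟩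
      g ⟨$⟩ʳ x                   ∎
      where open ≡-Reasoning
    f-free : ∀ (g : Perm n) → ¬ (g ∘ₚ τ ≈ g)
    f-free g gτ≈g = ρᵘ≉id λ y → begin
      iter ρ u y                          ≡⟨ pow-apply ρ u y ⟨
      τ ⟨$⟩ʳ y                            ≡⟨ cong (τ ⟨$⟩ʳ_) (inverseʳ g) ⟨
      τ ⟨$⟩ʳ (g ⟨$⟩ʳ (g ⟨$⟩ˡ y))          ≡⟨ gτ≈g (g ⟨$⟩ˡ y) ⟩
      g ⟨$⟩ʳ (g ⟨$⟩ˡ y)                   ≡⟨ inverseʳ g ⟩
      y                                   ∎
      where open ≡-Reasoning

⟨$⟩ʳ-punchIn : ∀ {m} {F : Fin (suc m)} (ρ : Perm (suc m)) → ρ ⟨$⟩ʳ F ≡ F →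
  ∀ j → ρ ⟨$⟩ʳ punchIn F j ≡ punchIn F (remove F ρ ⟨$⟩ʳ j)
⟨$⟩ʳ-punchIn {F = F} ρ ρF≡F j = trans (punchIn-permute ρ F j) (cong (λ t → punchIn t (remove F ρ ⟨$⟩ʳ j)) ρF≡F)

module _ {m : ℕ} {F : Fin (suc m)} (ρ τ : Perm (suc m)) (ρF≡F : ρ ⟨$⟩ʳ F ≡ F) (τF≡F : τ ⟨$⟩ʳ F ≡ F) where

  agree-punchIn⇔agree-remove : ∀ j →
    (ρ ⟨$⟩ʳ punchIn F j ≡ τ ⟨$⟩ʳ punchIn F j) ⇔ (remove F ρ ⟨$⟩ʳ j ≡ remove F τ ⟨$⟩ʳ j)
  agree-punchIn⇔agree-remove j = mk⇔
    (λ agree → punchIn-injective F _ _ (trans (sym (⟨$⟩ʳ-punchIn ρ ρF≡F j)) (trans agree (⟨$⟩ʳ-punchIn τ τF≡F j))))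
    (λ agree → trans (⟨$⟩ʳ-punchIn ρ ρF≡F j) (trans (cong (punchIn F) agree) (sym (⟨$⟩ʳ-punchIn τ τF≡F j))))

  ≈⇔remove-≈ : ρ ≈ τ ⇔ remove F ρ ≈ remove F τ
  ≈⇔remove-≈ = mk⇔ (λ ρ≈τ j → Equivalence.to (agree-punchIn⇔agree-remove j) (ρ≈τ (punchIn F j))) from
    where
    from : remove F ρ ≈ remove F τ → ρ ≈ τ
    from ρ₋≈τ₋ x with F ≟ x
    ... | yes refl = trans ρF≡F (sym τF≡F)
    ... | no F≢x = subst (λ y → ρ ⟨$⟩ʳ y ≡ τ ⟨$⟩ʳ y) (punchIn-punchOut F≢x)
                     (Equivalence.from (agree-punchIn⇔agree-remove (punchOut F≢x)) (ρ₋≈τ₋ (punchOut F≢x)))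

  hd-remove : hd ρ τ ≡ hd (remove F ρ) (remove F τ)
  hd-remove = begin
    hd ρ τ
      ≡⟨ count-punchIn (disagree? ρ τ) F ⟩
    length (filter (disagree? ρ τ) [ F ]) + count (disagree? ρ τ ∘ punchIn F)
      ≡⟨ cong (λ ys → length ys + count (disagree? ρ τ ∘ punchIn F))
              (filter-reject (disagree? ρ τ) (λ ρF≢τF → ρF≢τF (trans ρF≡F (sym τF≡F)))) ⟩
    count (disagree? ρ τ ∘ punchIn F)
      ≡⟨ count-cong (disagree? ρ τ ∘ punchIn F) (disagree? (remove F ρ) (remove F τ))
                    ( (λ {j} → Equivalence.to (¬-cong-⇔ (agree-punchIn⇔agree-remove j)))
                    , (λ {j} → Equivalence.from (¬-cong-⇔ (agree-punchIn⇔agree-remove j)))) ⟩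
    hd (remove F ρ) (remove F τ)
      ∎
    where open ≡-Reasoning

module _ {k : ℕ} (f : A → Perm k) where

  ≈?-on : B.Decidable (λ a b → f a ≈ f b)
  ≈?-on a b = f a ≈? f b

  card-map : ∀ xs → card (map f xs) ≡ length (deduplicate ≈?-on xs)
  card-map xs = trans (cong length (deduplicate-map _≈?_ f xs)) (length-map f (deduplicate ≈?-on xs))

  hdSet-map : ∀ xs →
    hdSet (map f xs) ≡ minimum? (map (λ p → hd (f (proj₁ p)) (f (proj₂ p))) (pairs (deduplicate ≈?-on xs)))
  hdSet-map xs = cong minimum? (begin
    map hd′ (pairs (distinct (map f xs)))                          ≡⟨ cong (map hd′ ∘ pairs) (deduplicate-map _≈?_ f xs) ⟩
    map hd′ (pairs (map f (deduplicate ≈?-on xs)))                 ≡⟨ cong (map hd′) (pairs-map f (deduplicate ≈?-on xs)) ⟩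
    map hd′ (map (Product.map f f) (pairs (deduplicate ≈?-on xs))) ≡⟨ map-∘ (pairs (deduplicate ≈?-on xs)) ⟨
    map (hd′ ∘ Product.map f f) (pairs (deduplicate ≈?-on xs))     ∎)
    where
    open ≡-Reasoning
    hd′ = λ (p : Perm k × Perm k) → hd (proj₁ p) (proj₂ p)

module _ {k k′ : ℕ} (f : A → Perm k) (g : A → Perm k′) (xs : List A)
         (f≈⇔g≈ : ∀ {a b} → a ∈ xs → b ∈ xs → f a ≈ f b ⇔ g a ≈ g b) where

  card-map-cong : card (map f xs) ≡ card (map g xs)
  card-map-cong = trans (card-map f xs) (trans (cong length (deduplicate-cong (≈?-on f) (≈?-on g) f≈⇔g≈)) (sym (card-map g xs)))

  hdSet-map-cong : (∀ a b → hd (f a) (f b) ≡ hd (g a) (g b)) → hdSet (map f xs) ≡ hdSet (map g xs)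
  hdSet-map-cong hd-f≡hd-g = begin
    hdSet (map f xs)                                                         ≡⟨ hdSet-map f xs ⟩
    minimum? (map (λ p → hd (f (proj₁ p)) (f (proj₂ p))) (pairs (deduplicate (≈?-on f) xs)))
      ≡⟨ cong (λ ys → minimum? (map (λ p → hd (f (proj₁ p)) (f (proj₂ p))) (pairs ys)))
              (deduplicate-cong (≈?-on f) (≈?-on g) f≈⇔g≈) ⟩
    minimum? (map (λ p → hd (f (proj₁ p)) (f (proj₂ p))) (pairs (deduplicate (≈?-on g) xs)))
      ≡⟨ cong minimum? (map-cong (λ p → hd-f≡hd-g (proj₁ p) (proj₂ p)) (pairs (deduplicate (≈?-on g) xs))) ⟩
    minimum? (map (λ p → hd (g (proj₁ p)) (g (proj₂ p))) (pairs (deduplicate (≈?-on g) xs)))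
      ≡⟨ hdSet-map g xs ⟨
    hdSet (map g xs)                                                         ∎
    where open ≡-Reasoning

∈-distinct : ∀ {k} {S : List (Perm k)} {π} → π ∈ S → ∃[ π′ ] π′ ∈ distinct S × π ≈ π′
∈-distinct π∈S = find (Any.deduplicate⁺ _≈?_ (λ σ≈τ π≈τ x → trans (π≈τ x) (sym (σ≈τ x))) (Any.map (λ { refl _ → refl }) π∈S))

hdSet-≤ : ∀ {k} {S : List (Perm k)} {d π σ} → hdSet S ≡ just d → π ∈ S → σ ∈ S → ¬ π ≈ σ → d ≤ hd π σ
hdSet-≤ {d = d} {π} {σ} hdS≡d π∈S σ∈S π≉σ
  with π′ , π′∈D , π≈π′ ← ∈-distinct π∈S
  with σ′ , σ′∈D , σ≈σ′ ← ∈-distinct σ∈S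
  with ∈-pairs π′∈D σ′∈D
... | inj₁ refl = contradiction (λ x → trans (π≈π′ x) (sym (σ≈σ′ x))) π≉σ
... | inj₂ (inj₁ π′σ′∈) = begin
  d           ≤⟨ minimum?-≤ hdS≡d (∈-map⁺ (λ p → hd (proj₁ p) (proj₂ p)) π′σ′∈) ⟩
  hd π′ σ′    ≡⟨ hd-cong {π = π} {π′} {σ} {σ′} π≈π′ σ≈σ′ ⟨
  hd π σ      ∎
  where open ≤-Reasoning
... | inj₂ (inj₂ σ′π′∈) = begin
  d           ≤⟨ minimum?-≤ hdS≡d (∈-map⁺ (λ p → hd (proj₁ p) (proj₂ p)) σ′π′∈) ⟩
  hd σ′ π′    ≡⟨ hd-comm σ′ π′ ⟩
  hd π′ σ′    ≡⟨ hd-cong {π = π} {π′} {σ} {σ′} π≈π′ σ≈σ′ ⟨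
  hd π σ      ∎
  where open ≤-Reasoning

module _ {n : ℕ} (F : Fin n) where

  tri-cong : ∀ {π σ : Perm n} → π ≈ σ → tri F π ≈ tri F σ
  tri-cong π≈σ x = cong₂ (λ πF πx → transpose F πF ⟨$⟩ʳ πx) (π≈σ F) (π≈σ x)

  tri-injective : ∀ {S : List (Perm n)} {d π σ} → hdSet S ≡ just d → 3 < d →
    π ∈ S → σ ∈ S → tri F π ≈ tri F σ → π ≈ σ
  tri-injective {d = d} {π} {σ} hdS≡d 3<d π∈S σ∈S tri-π≈tri-σ with π ≈? σ
  ... | yes π≈σ = π≈σ
  ... | no π≉σ = contradiction 3<3 (<-irrefl refl)
    where
    open ≤-Reasoning
    3<3 : 3 < 3
    3<3 = begin-strict
      3                               <⟨ 3<d ⟩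
      d                               ≤⟨ hdSet-≤ hdS≡d π∈S σ∈S π≉σ ⟩
      hd π σ                          ≤⟨ hd≤3+hd-tri F π σ ⟩
      3 + hd (tri F π) (tri F σ)      ≡⟨ cong (3 +_) (hd-≈ {π = tri F π} {tri F σ} tri-π≈tri-σ) ⟩
      3                               ∎

lemma2 : (m : ℕ) (F : Fin (suc m)) (G : List (Perm (suc m))) → IsPermGroup G →
         ((π σ : Perm (suc m)) → π ∈ₚ G → σ ∈ₚ G →
           (((x : Fin (suc m)) →
               (tri F π ⟨$⟩ʳ x ≢ π ⟨$⟩ʳ x) ⊎ (tri F σ ⟨$⟩ʳ x ≢ σ ⟨$⟩ʳ x) →
               (x ≡ π ⟨$⟩ˡ F) ⊎ (x ≡ σ ⟨$⟩ˡ F) ⊎ (x ≡ F))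
            × (hd π σ ∸ 3 ≤ hd (tri F π) (tri F σ)))
           × (hd (tri F π) (tri F σ) + 3 ≡ hd π σ →
                HasCycleOfLength (π · flip σ) 3 × (3 ∣ length G)))
         × ((S : List (Perm (suc m))) → All (_∈ₚ G) S →
             (card (map (tri F) S) ≡ card (map (tri₋ F) S))
             × (hdSet (map (tri F) S) ≡ hdSet (map (tri₋ F) S))
             × ((d : ℕ) → hdSet S ≡ just d → 3 < d → card S ≡ card (map (tri F) S)))
lemma2 m F G isG =
  (λ π σ π∈G σ∈G →
    ( (λ x → Sum.[ Sum.map₂ inj₂ ∘ tri-moves F π , inj₂ ∘ tri-moves F σ ])
    , m≤n+o⇒m∸n≤o (hd π σ) 3 (hd≤3+hd-tri F π σ))
    , λ tight → let ρ-has-3-cycle = hd-tri+3≡hd⇒3-cycle F π σ tight in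
        ρ-has-3-cycle , 3∣order isG (closed-∘ (flip σ) π (closed-⁻¹ σ σ∈G) π∈G) ρ-has-3-cycle)
  , λ S _ →
      card-map-cong (tri F) (tri₋ F) S (λ {π} {σ} _ _ → tri≈⇔tri₋≈ π σ)
    , hdSet-map-cong (tri F) (tri₋ F) S (λ {π} {σ} _ _ → tri≈⇔tri₋≈ π σ)
        (λ π σ → hd-remove (tri F π) (tri F σ) (tri-F F π) (tri-F F σ))
    , λ d hdS≡d 3<d → trans (cong card (sym (map-id S)))
        (card-map-cong id (tri F) S (λ {π} {σ} π∈S σ∈S → mk⇔ (tri-cong F {π} {σ}) (tri-injective F hdS≡d 3<d π∈S σ∈S)))
  where
  open IsPermGroup isG
  tri≈⇔tri₋≈ : ∀ π σ → tri F π ≈ tri F σ ⇔ tri₋ F π ≈ tri₋ F σ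
  tri≈⇔tri₋≈ π σ = ≈⇔remove-≈ (tri F π) (tri F σ) (tri-F F π) (tri-F F σ)
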